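{- Let $G$ be a graph with diameter $d$ and let $s,t$ be vertices of $G$. If there exists an alternation strategy such that the bidirectional BFS between $s$ and $t$ explores $f(n)$ edges, then the bidirectional BFS between $s$ and $t$ with greedy alternation strategy explores at most $d\cdot f(n)$ edges.
   Context: $G=(V,E)$ is an undirected, unweighted, connected graph with $n$ vertices. For a vertex $s$, the BFS from $s$ has layers $L^s_0=\{s\}$ and $L^s_{i+1}$ = the neighbors of vertices in $L^s_i$ not contained in earlier layers; computing $L^s_{i+1}$ from $L^s_i$ is an exploration step, which explores the $c^s_i := \sum_{v\in L^s_i}\deg(v)$ edges incident to $L^s_i$. The bidirectional BFS runs a forward BFS from $s$ and a backward BFS from $t$; an alternation strategy decides, after each full exploration step, which of the two searches performs the next exploration step (steps are never interrupted). The bidirectional BFS stops once some vertex has been found by both searches. The greedy alternation strategy: if the latest layers are $L^s_i$ and $L^t_j$, perform the next exploration step in the forward search if $c^s_i \le c^t_j$ and in the backward search otherwise. -}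

module Defs where

open import Data.Nat using (ℕ; zero; suc; _+_; _*_; _≤_; _<_; _≤ᵇ_)
open import Data.Fin using (Fin)
open import Data.Fin.Subset using (Subset; _∈_; _∉_; ⁅_⁆; ∣_∣; _∩_; _∪_; ∁; ⋃)
open import Data.Bool using (Bool; true; false; if_then_else_)
open import Data.Vec using (lookup)
open import Data.List using (List; []; _∷_; map; allFin; filterᵇ)
open import Data.Nat.ListAction using (sum)
open import Data.Product using (Σ; ∃; _×_; _,_; proj₁; proj₂)
open import Relation.Binary.PropositionalEquality using (_≡_)
open import Relation.Nullary using (¬_)

record Graph (n : ℕ) : Set where
  field
    N      : Fin n → Subset n
    sym    : ∀ u v → u ∈ N v → v ∈ N u
    irrefl : ∀ v → v ∉ N v
open Graph public

module _ {n : ℕ} (G : Graph n) where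

  data Walk : Fin n → Fin n → ℕ → Set where
    here : ∀ {u} → Walk u u 0
    step : ∀ {u w v k} → w ∈ N G u → Walk w v k → Walk u v (suc k)

  Connected : Set
  Connected = ∀ u v → ∃ λ k → Walk u v k

  HasDiameter : ℕ → Set
  HasDiameter d =
    (∀ u v → ∃ λ k → k ≤ d × Walk u v k) ×
    (∃ λ u → ∃ λ v → ∀ k → Walk u v k → d ≤ k)

  deg : Fin n → ℕ
  deg v = ∣ N G v ∣

  members : Subset n → List (Fin n)
  members S = filterᵇ (λ v → lookup S v) (allFin n)

  nbhd : Subset n → Subset n
  nbhd S = ⋃ (map (N G) (members S))

  -- BFS from s: bfs s i = (L^s_i , L^s_0 ∪ … ∪ L^s_i)
  bfs : Fin n → ℕ → Subset n × Subset n
  bfs s zero = ⁅ s ⁆ , ⁅ s ⁆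
  bfs s (suc i) =
    let L  = proj₁ (bfs s i)
        V  = proj₂ (bfs s i)
        L′ = nbhd L ∩ ∁ V
    in L′ , V ∪ L′

  layer : Fin n → ℕ → Subset n
  layer s i = proj₁ (bfs s i)

  visited : Fin n → ℕ → Subset n
  visited s i = proj₂ (bfs s i)

  -- c^s_i = Σ_{v ∈ L^s_i} deg v : the number of edges explored by step i
  c : Fin n → ℕ → ℕ
  c s i = sum (map deg (members (layer s i)))

  sumBelow : (ℕ → ℕ) → ℕ → ℕ
  sumBelow f zero = 0
  sumBelow f (suc i) = sumBelow f i + f i

  -- An alternation strategy: given the history of previous decisions
  -- (most recent first; true = forward step, false = backward step),
  -- decide which search performs the next exploration step.
  -- (G, s, t are fixed, so everything observable so far is a function
  -- of this history.)
  Strategy : Set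
  Strategy = List Bool → Bool

  record State : Set where
    constructor ⟨_,_,_⟩
    field
      fw   : ℕ
      bw   : ℕ
      hist : List Bool
  open State public

  run : Strategy → ℕ → State
  run σ zero = ⟨ 0 , 0 , [] ⟩
  run σ (suc k) = next (run σ k)
    where
    next : State → State
    next ⟨ i , j , h ⟩ = if σ h then ⟨ suc i , j , true ∷ h ⟩
                                 else ⟨ i , suc j , false ∷ h ⟩

  module _ (s t : Fin n) where

    Met : State → Set
    Met st = ∃ λ v → v ∈ visited s (fw st) × v ∈ visited t (bw st)

    cost : State → ℕ
    cost st = sumBelow (c s) (fw st) + sumBelow (c t) (bw st)

    Explores : Strategy → ℕ → Set
    Explores σ e = Σ ℕ λ k →
      Met (run σ k) × (∀ k′ → k′ < k → ¬ Met (run σ k′)) × e ≡ cost (run σ k)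

    countF countB : List Bool → ℕ
    countF [] = 0
    countF (true ∷ h) = suc (countF h)
    countF (false ∷ h) = countF h
    countB [] = 0
    countB (true ∷ h) = countB h
    countB (false ∷ h) = suc (countB h)

    greedy : Strategy
    greedy h = c s (countF h) ≤ᵇ c t (countB h)

-- Let σ meet with i* forward and j* backward steps done, at total cost F.
-- While greedy has not met after i forward and j backward steps, the
-- visited sets being monotone forces i < i* or j < j*, so one of the two
-- pending steps costs at most F; greedy takes the cheaper one, so each of
-- its steps costs at most F. Every alternation has met once i + j reaches
-- dist(s,t) ≤ d, so greedy stops within d steps.
module Submission where

open import Defs
open import Data.Nat
  using (ℕ; zero; suc; _+_; _*_; _⊓_; _≤_; _<_; _≤ᵇ_; _≤′_; ≤′-refl; ≤′-step; z≤n; s≤s)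
open import Data.Nat.Properties
open import Algebra.Properties.CommutativeSemigroup +-commutativeSemigroup using (xy∙z≈xz∙y)
open import Data.Fin using (Fin)
open import Data.Fin.Properties using (any?)
open import Data.Fin.Subset using (_∈_; _⊆_; ⋃)
open import Data.Fin.Subset.Properties
  using (_∈?_; x∈⁅x⁆; p⊆p∪q; q⊆p∪q; x∈p∪q⁻; x∈p∩q⁺; x∉p⇒x∈∁p)
open import Data.Bool using (true; false; T; if_then_else_)
open import Data.Unit using (tt)
open import Data.Vec using (lookup)
open import Data.Vec.Properties using ([]=⇒lookup)
open import Data.List using (_∷_; map)
import Data.List.Membership.Propositional as List
open import Data.List.Membership.Propositional.Properties using (∈-filter⁺; ∈-allFin)
open import Data.List.Relation.Unary.Any using (here; there)
open import Data.Product using (∃; _×_; _,_)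
open import Data.Sum using (_⊎_; inj₁; inj₂)
open import Function using (_∘_)
open import Relation.Binary.PropositionalEquality
  using (_≡_; refl; cong; subst; trans; module ≡-Reasoning)
  renaming (sym to ≡-sym)
open import Relation.Nullary using (¬_; Dec; yes; no; contradiction)
open import Relation.Nullary.Decidable using (T?; _×-dec_)
open import Relation.Nullary.Reflects using (ofʸ; ofⁿ)

least-witness-≤ : ∀ {p} {P : ℕ → Set p} → (∀ k → Dec (P k)) →
  ∀ D → (∃ λ k → k ≤ D × P k) →
  ∃ λ k → k ≤ D × P k × (∀ k′ → k′ < k → ¬ P k′)
least-witness-≤ P? zero (zero , z≤n , Pk) = zero , z≤n , Pk , λ _ ()
least-witness-≤ P? (suc D) (k , k≤ , Pk) with anyUpTo? P? (suc D)
... | yes (k′ , s≤s k′≤D , Pk′) =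
  let (m , m≤D , Pm , least) = least-witness-≤ P? D (k′ , k′≤D , Pk′)
  in m , m≤n⇒m≤1+n m≤D , Pm , least
... | no none = k , k≤ , Pk , λ k′ k′<k Pk′ → none (k′ , <-≤-trans k′<k k≤ , Pk′)

module _ {n : ℕ} (G : Graph n) where

  sumBelow-mono : ∀ f {i m} → i ≤ m → sumBelow G f i ≤ sumBelow G f m
  sumBelow-mono f = go ∘ ≤⇒≤′
    where
    go : ∀ {i m} → i ≤′ m → sumBelow G f i ≤ sumBelow G f m
    go ≤′-refl = ≤-refl
    go (≤′-step i≤′m) = ≤-trans (go i≤′m) (m≤m+n _ _)

  term≤sumBelow : ∀ f {i m} → i < m → f i ≤ sumBelow G f m
  term≤sumBelow f {i} i<m = ≤-trans (m≤n+m (f i) _) (sumBelow-mono f i<m)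

  ∈-⋃-map : ∀ ws {w x} → w List.∈ ws → x ∈ N G w → x ∈ ⋃ (map (N G) ws)
  ∈-⋃-map (w ∷ ws) (here refl) x∈ = p⊆p∪q (⋃ (map (N G) ws)) x∈
  ∈-⋃-map (w ∷ ws) (there w∈) x∈ = q⊆p∪q (N G w) _ (∈-⋃-map ws w∈ x∈)

  ∈-members : ∀ {S w} → w ∈ S → w List.∈ members G S
  ∈-members {S} {w} w∈S =
    ∈-filter⁺ (T? ∘ lookup S) (∈-allFin w) (subst T (≡-sym ([]=⇒lookup w∈S)) tt)

  ∈-nbhd : ∀ {S w x} → w ∈ S → x ∈ N G w → x ∈ nbhd G S
  ∈-nbhd {S} w∈S = ∈-⋃-map (members G S) (∈-members w∈S)

  module _ (s : Fin n) where

    visited-mono : ∀ {i j} → i ≤ j → visited G s i ⊆ visited G s j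
    visited-mono = go ∘ ≤⇒≤′
      where
      go : ∀ {i j} → i ≤′ j → visited G s i ⊆ visited G s j
      go ≤′-refl x∈ = x∈
      go (≤′-step i≤′j) x∈ = p⊆p∪q _ (go i≤′j x∈)

    visited⇒layer : ∀ i {x} → x ∈ visited G s i → ∃ λ j → j ≤ i × x ∈ layer G s j
    visited⇒layer zero x∈ = zero , z≤n , x∈
    visited⇒layer (suc i) x∈ with x∈p∪q⁻ (visited G s i) _ x∈
    ... | inj₁ x∈V = let (j , j≤i , x∈L) = visited⇒layer i x∈V in j , m≤n⇒m≤1+n j≤i , x∈L
    ... | inj₂ x∈L = suc i , ≤-refl , x∈L

    layer-neighbour : ∀ j {w x} → w ∈ layer G s j → x ∈ N G w → x ∈ visited G s (suc j)
    layer-neighbour j {x = x} w∈ x∈ with x ∈? visited G s j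
    ... | yes x∈V = p⊆p∪q _ x∈V
    ... | no x∉V = q⊆p∪q (visited G s j) _ (x∈p∩q⁺ (∈-nbhd w∈ x∈ , x∉p⇒x∈∁p x∉V))

    visited-neighbour : ∀ i {w x} → w ∈ visited G s i → x ∈ N G w → x ∈ visited G s (suc i)
    visited-neighbour i w∈ x∈ =
      let (j , j≤i , w∈L) = visited⇒layer i w∈
      in visited-mono (s≤s j≤i) (layer-neighbour j w∈L x∈)

    walk⇒visited : ∀ {v k} → Walk G v s k → v ∈ visited G s k
    walk⇒visited here = x∈⁅x⁆ s
    walk⇒visited {k = suc k} (step {u} {w} e walk) =
      visited-neighbour k (walk⇒visited walk) (Graph.sym G w u e)

  module _ (s t : Fin n) where

    -- The forward search follows the walk for i steps; the backward search
    -- covers the remaining k ∸ i ≤ j steps from t.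
    meet-on-walk : ∀ i j {m u k} → u ∈ visited G s m → Walk G u t k → k ≤ i + j →
      ∃ λ v → v ∈ visited G s (m + i) × v ∈ visited G t j
    meet-on-walk zero j {m} u∈ walk k≤j =
      _ , subst (λ l → _ ∈ visited G s l) (≡-sym (+-identityʳ m)) u∈ ,
      visited-mono t k≤j (walk⇒visited t walk)
    meet-on-walk (suc i) j {m} u∈ here _ =
      t , visited-mono s (m≤m+n m (suc i)) u∈ , visited-mono t {0} {j} z≤n (x∈⁅x⁆ t)
    meet-on-walk (suc i) j {m} u∈ (step e walk) (s≤s k≤i+j) =
      let (v , v∈s , v∈t) = meet-on-walk i j {suc m} (visited-neighbour s m u∈ e) walk k≤i+j
      in v , subst (λ l → v ∈ visited G s l) (≡-sym (+-suc m i)) v∈s , v∈t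

    run-fw+bw : ∀ σ k → fw (run G σ k) + bw (run G σ k) ≡ k
    run-fw+bw σ zero = refl
    run-fw+bw σ (suc k) with σ (hist (run G σ k)) | run-fw+bw σ k
    ... | true  | fw+bw≡k = cong suc fw+bw≡k
    ... | false | fw+bw≡k = trans (+-suc _ _) (cong suc fw+bw≡k)

    walk⇒met : ∀ σ {k} → Walk G s t k → Met G s t (run G σ k)
    walk⇒met σ {k} walk =
      meet-on-walk (fw (run G σ k)) (bw (run G σ k)) {0} (x∈⁅x⁆ s) walk
        (≤-reflexive (≡-sym (run-fw+bw σ k)))

    Met? : ∀ st → Dec (Met G s t st)
    Met? st = any? λ v → (v ∈? visited G s (fw st)) ×-dec (v ∈? visited G t (bw st))

    unmet⇒behind : ∀ st* st → Met G s t st* → ¬ Met G s t st →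
      fw st < fw st* ⊎ bw st < bw st*
    unmet⇒behind st* st (v , v∈s , v∈t) unmet with fw st <? fw st* | bw st <? bw st*
    ... | yes i<i* | _ = inj₁ i<i*
    ... | no _ | yes j<j* = inj₂ j<j*
    ... | no i≮i* | no j≮j* =
      contradiction (v , visited-mono s (≮⇒≥ i≮i*) v∈s , visited-mono t (≮⇒≥ j≮j*) v∈t) unmet

    unmet⇒cheaper-step≤cost : ∀ st* st → Met G s t st* → ¬ Met G s t st →
      c G s (fw st) ⊓ c G t (bw st) ≤ cost G s t st*
    unmet⇒cheaper-step≤cost st* st met* unmet with unmet⇒behind st* st met* unmet
    ... | inj₁ i<i* = ≤-trans (m⊓n≤m _ _) (≤-trans (term≤sumBelow (c G s) i<i*) (m≤m+n _ _))
    ... | inj₂ j<j* = ≤-trans (m⊓n≤n _ _) (≤-trans (term≤sumBelow (c G t) j<j*) (m≤n+m _ _))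

    hist-counts : ∀ σ k → countF G s t (hist (run G σ k)) ≡ fw (run G σ k)
                        × countB G s t (hist (run G σ k)) ≡ bw (run G σ k)
    hist-counts σ zero = refl , refl
    hist-counts σ (suc k) with σ (hist (run G σ k)) | hist-counts σ k
    ... | true  | #F , #B = cong suc #F , #B
    ... | false | #F , #B = #F , cong suc #B

    forward-step-cost : ∀ i j {h h′} → c G s i ≤ c G t j →
      cost G s t ⟨ suc i , j , h ⟩ ≡ cost G s t ⟨ i , j , h′ ⟩ + c G s i ⊓ c G t j
    forward-step-cost i j a≤b = begin
      A + a + B      ≡⟨ xy∙z≈xz∙y A a B ⟩
      A + B + a      ≡⟨ cong (A + B +_) (m≤n⇒m⊓n≡m a≤b) ⟨
      A + B + a ⊓ b  ∎
      where
      open ≡-Reasoning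
      A = sumBelow G (c G s) i
      B = sumBelow G (c G t) j
      a = c G s i
      b = c G t j

    backward-step-cost : ∀ i j {h h′} → c G t j ≤ c G s i →
      cost G s t ⟨ i , suc j , h ⟩ ≡ cost G s t ⟨ i , j , h′ ⟩ + c G s i ⊓ c G t j
    backward-step-cost i j b≤a = begin
      A + (B + b)    ≡⟨ +-assoc A B b ⟨
      A + B + b      ≡⟨ cong (A + B +_) (m≥n⇒m⊓n≡n b≤a) ⟨
      A + B + a ⊓ b  ∎
      where
      open ≡-Reasoning
      A = sumBelow G (c G s) i
      B = sumBelow G (c G t) j
      a = c G s i
      b = c G t j

    greedy-step-cost : ∀ k → let st = run G (greedy G s t) k in
      cost G s t (run G (greedy G s t) (suc k)) ≡ cost G s t st + c G s (fw st) ⊓ c G t (bw st)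
    greedy-step-cost k = advance-cost (run G (greedy G s t) k) (hist-counts (greedy G s t) k)
      where
      -- run σ (suc k) unfolds to advance σ (run σ k).
      advance : Strategy G → State G → State G
      advance σ ⟨ i , j , h ⟩ = if σ h then ⟨ suc i , j , true ∷ h ⟩ else ⟨ i , suc j , false ∷ h ⟩

      advance-cost : ∀ st → countF G s t (hist st) ≡ fw st × countB G s t (hist st) ≡ bw st →
        cost G s t (advance (greedy G s t) st) ≡ cost G s t st + c G s (fw st) ⊓ c G t (bw st)
      advance-cost ⟨ _ , _ , h ⟩ (refl , refl)
        with c G s (countF G s t h) ≤ᵇ c G t (countB G s t h)
           | ≤ᵇ-reflects-≤ (c G s (countF G s t h)) (c G t (countB G s t h))
      ... | true  | ofʸ a≤b = forward-step-cost (countF G s t h) (countB G s t h) {true ∷ h} {h} a≤b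
      ... | false | ofⁿ a≰b = backward-step-cost (countF G s t h) (countB G s t h) {false ∷ h} {h} (≰⇒≥ a≰b)

    greedy-cost≤steps*cost : ∀ st* k → Met G s t st* →
      (∀ k′ → k′ < k → ¬ Met G s t (run G (greedy G s t) k′)) →
      cost G s t (run G (greedy G s t) k) ≤ k * cost G s t st*
    greedy-cost≤steps*cost st* zero _ _ = z≤n
    greedy-cost≤steps*cost st* (suc k) met* unmet = begin
      cost G s t (run G (greedy G s t) (suc k))
        ≡⟨ greedy-step-cost k ⟩
      cost G s t st + c G s (fw st) ⊓ c G t (bw st)
        ≤⟨ +-mono-≤ (greedy-cost≤steps*cost st* k met* (λ k′ k′<k → unmet k′ (m≤n⇒m≤1+n k′<k)))
                    (unmet⇒cheaper-step≤cost st* st met* (unmet k ≤-refl)) ⟩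
      k * F + F
        ≡⟨ +-comm (k * F) F ⟩
      suc k * F ∎
      where
      open ≤-Reasoning
      st = run G (greedy G s t) k
      F = cost G s t st*

theorem5 : (n : ℕ) (G : Graph n) → Connected G →
    (d : ℕ) → HasDiameter G d →
    (s t : Fin n) → (f : ℕ → ℕ) →
    (∃ λ σ → Explores G s t σ (f n)) →
    ∃ λ e → Explores G s t (greedy G s t) e × e ≤ d * f n
theorem5 n G _ d (close , _) s t f (σ , k* , met* , _ , fn≡cost)
  with close s t
... | D , D≤d , walk
  with least-witness-≤ (Met? G s t ∘ run G (greedy G s t)) D
                       (D , ≤-refl , walk⇒met G s t (greedy G s t) walk)
... | k , k≤D , met , first =
  cost G s t (run G (greedy G s t) k) , (k , met , first , refl) , (begin
  cost G s t (run G (greedy G s t) k)  ≤⟨ greedy-cost≤steps*cost G s t (run G σ k*) k met* first ⟩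
  k * F                                ≤⟨ *-monoˡ-≤ F (≤-trans k≤D D≤d) ⟩
  d * F                                ≡⟨ cong (d *_) fn≡cost ⟨
  d * f n                              ∎)
  where
  open ≤-Reasoning
  F = cost G s t (run G σ k*)
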